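{- The sequent calculus $\mathtt{LSkG}$ is cut-free, i.e. the following two cut rules are admissible (whenever their premises are derivable, so is their conclusion): (scut) from $S \mid \Gamma \vdash A$ and $A \mid \Delta \vdash C$ infer $S \mid \Gamma, \Delta \vdash C$; (ccut) from ${ - } \mid \Gamma \vdash A$ and $S \mid \Delta_0, A, \Delta_1 \vdash C$ infer $S \mid \Delta_0, \Gamma, \Delta_1 \vdash C$. Here $S$ ranges over stoups, $\Gamma,\Delta,\Delta_0,\Delta_1$ over lists of formulae and $A,C$ over formulae.
   Context: Formulae are generated by $A,B ::= X \mid \mathsf{I} \mid A \otimes B \mid A \multimap B$, where $X$ ranges over a set $\mathsf{At}$ of atoms. A sequent of $\mathtt{LSkG}$ has the form $S \mid \Gamma \vdash A$, where the stoup $S$ is either a single formula or empty (written $S = { - }$), $\Gamma$ is a finite ordered list of formulae (the context), and $A$ is a formula. Derivations of $\mathtt{LSkG}$ are generated by the rules: (ax) $A \mid\ \vdash A$; ($\multimap$L) from ${ - } \mid \Gamma \vdash A$ and $B \mid \Delta \vdash C$ infer $A \multimap B \mid \Gamma,\Delta \vdash C$; (IL) from ${ - } \mid \Gamma \vdash C$ infer $\mathsf{I} \mid \Gamma \vdash C$; ($\otimes$L) from $A \mid B,\Gamma \vdash C$ infer $A\otimes B \mid \Gamma \vdash C$; (pass) from $A \mid \Gamma \vdash C$ infer ${ - } \mid A,\Gamma \vdash C$; ($\multimap$R) from $S \mid \Gamma, A \vdash B$ infer $S \mid \Gamma \vdash A \multimap B$; (IR) ${ - } \mid\ \vdash \mathsf{I}$;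 ($\otimes$R) from $S \mid \Gamma \vdash A$ and ${ - } \mid \Delta \vdash B$ infer $S \mid \Gamma,\Delta \vdash A \otimes B$. -}

module Defs where

open import Data.List using (List; []; _∷_; _++_)
open import Data.Maybe using (Maybe; just; nothing)

data Fma (At : Set) : Set where
  ` : At → Fma At
  I : Fma At
  _⊗_ : Fma At → Fma At → Fma At
  _⊸_ : Fma At → Fma At → Fma At

infixl 25 _⊗_
infixr 20 _⊸_

-- Stoup: either empty (nothing, written −) or a single formula (just A)
Stp : Set → Set
Stp At = Maybe (Fma At)

Cxt : Set → Set
Cxt At = List (Fma At)

infix 15 _∣_⊢_
data _∣_⊢_ {At : Set} : Stp At → Cxt At → Fma At → Set where
  ax : {A : Fma At} → just A ∣ [] ⊢ A
  ⊸L : {Γ Δ : Cxt At} {A B C : Fma At} →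
       nothing ∣ Γ ⊢ A → just B ∣ Δ ⊢ C → just (A ⊸ B) ∣ Γ ++ Δ ⊢ C
  IL : {Γ : Cxt At} {C : Fma At} →
       nothing ∣ Γ ⊢ C → just I ∣ Γ ⊢ C
  ⊗L : {Γ : Cxt At} {A B C : Fma At} →
       just A ∣ B ∷ Γ ⊢ C → just (A ⊗ B) ∣ Γ ⊢ C
  pass : {Γ : Cxt At} {A C : Fma At} →
         just A ∣ Γ ⊢ C → nothing ∣ A ∷ Γ ⊢ C
  ⊸R : {S : Stp At} {Γ : Cxt At} {A B : Fma At} →
       S ∣ Γ ++ A ∷ [] ⊢ B → S ∣ Γ ⊢ A ⊸ B
  IR : nothing ∣ [] ⊢ I
  ⊗R : {S : Stp At} {Γ Δ : Cxt At} {A B : Fma At} →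
       S ∣ Γ ⊢ A → nothing ∣ Δ ⊢ B → S ∣ Γ ++ Δ ⊢ A ⊗ B

{-# OPTIONS --safe #-}
-- Simultaneous induction on the cut formula and then on the derivations.
-- A stoup cut commutes past the left rules of its first premise and the right
-- rules of its second; in the principal cases a cut on I vanishes and a cut on
-- A ⊸ B or A ⊗ B becomes cuts on A and B.  A context cut commutes past every
-- rule of its second premise except pass of the cut formula itself, which
-- turns it into a stoup cut.
module Submission where

open import Defs
open import Data.List using ([]; _∷_; _++_)
open import Data.List.Properties using (++-assoc; ++-identityʳ; ∷-injective)
open import Data.Maybe using (just; nothing)
open import Data.Product using (_×_; _,_; ∃)
open import Data.Sum using (_⊎_; inj₁; inj₂)
open import Relation.Binary.PropositionalEquality

module _ {At : Set} where

  cast : {S : Stp At} {Γ Γ' : Cxt At} {C : Fma At} → Γ ≡ Γ' → S ∣ Γ ⊢ C → S ∣ Γ' ⊢ C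
  cast {S} {C = C} = subst (λ Γ → S ∣ Γ ⊢ C)

  ++≡++∷-cases : (Γ Δ Δ₀ Δ₁ : Cxt At) {A : Fma At} → Γ ++ Δ ≡ Δ₀ ++ A ∷ Δ₁ →
    (∃ λ Λ → Γ ≡ Δ₀ ++ A ∷ Λ × Δ₁ ≡ Λ ++ Δ) ⊎ (∃ λ Λ → Δ ≡ Λ ++ A ∷ Δ₁ × Δ₀ ≡ Γ ++ Λ)
  ++≡++∷-cases []      Δ Δ₀       Δ₁ eq   = inj₂ (Δ₀ , eq , refl)
  ++≡++∷-cases (B ∷ Γ) Δ []       Δ₁ refl = inj₁ (Γ , refl , refl)
  ++≡++∷-cases (B ∷ Γ) Δ (B' ∷ Δ₀) Δ₁ eq
    with B≡B' , eq′ ← ∷-injective eq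
    with ++≡++∷-cases Γ Δ Δ₀ Δ₁ eq′
  ... | inj₁ (Λ , Γ≡ , Δ₁≡) = inj₁ (Λ , cong₂ _∷_ B≡B' Γ≡ , Δ₁≡)
  ... | inj₂ (Λ , Δ≡ , Δ₀≡) = inj₂ (Λ , Δ≡ , cong₂ _∷_ (sym B≡B') Δ₀≡)

  ++-assoc₄ : (Γ₀ Γ₁ Γ₂ Γ₃ : Cxt At) → (Γ₀ ++ Γ₁ ++ Γ₂) ++ Γ₃ ≡ Γ₀ ++ Γ₁ ++ Γ₂ ++ Γ₃
  ++-assoc₄ Γ₀ Γ₁ Γ₂ Γ₃ = trans (++-assoc Γ₀ (Γ₁ ++ Γ₂) Γ₃) (cong (Γ₀ ++_) (++-assoc Γ₁ Γ₂ Γ₃))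

  mutual
    scut : {S : Stp At} {Γ Δ : Cxt At} {A C : Fma At} →
      S ∣ Γ ⊢ A → just A ∣ Δ ⊢ C → S ∣ Γ ++ Δ ⊢ C
    scut ax g = g
    scut (⊸L {Γ} {Γ'} f₁ f₂) g = cast (sym (++-assoc Γ Γ' _)) (⊸L f₁ (scut f₂ g))
    scut (IL f) g = IL (scut f g)
    scut (⊗L f) g = ⊗L (scut f g)
    scut (pass f) g = pass (scut f g)
    scut {Γ = Γ} f ax = cast (sym (++-identityʳ Γ)) f
    scut {Γ = Γ} f (⊸R {Γ = Δ} {A = B} g) = ⊸R (cast (sym (++-assoc Γ Δ (B ∷ []))) (scut f g))
    scut {Γ = Γ} f (⊗R {Γ = Δ} {Δ = Δ'} g₁ g₂) = cast (++-assoc Γ Δ Δ') (⊗R (scut f g₁) g₂)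
    scut IR (IL g) = g
    scut {Γ = Γ} (⊸R f) (⊸L {Δ} {Δ'} g₁ g₂) =
      cast (++-assoc₄ Γ Δ [] Δ') (scut (ccut {Δ₀ = Γ} {Δ₁ = []} g₁ f refl) g₂)
    scut (⊗R {Γ = Γ} {Δ = Γ'} f₁ f₂) (⊗L {Γ = Δ} g) =
      cast (sym (++-assoc Γ Γ' Δ)) (ccut {Δ₀ = Γ} f₂ (scut f₁ g) refl)

    -- The context of g is only constrained by an equation, so that g can be
    -- matched on without unifying Δ₀ ++ A ∷ Δ₁ with the contexts of its premises.
    ccut : {S : Stp At} {Γ Δ Δ₀ Δ₁ : Cxt At} {A C : Fma At} →
      nothing ∣ Γ ⊢ A → S ∣ Δ ⊢ C → Δ ≡ Δ₀ ++ A ∷ Δ₁ → S ∣ Δ₀ ++ Γ ++ Δ₁ ⊢ C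
    ccut {Δ₀ = []}    f ax ()
    ccut {Δ₀ = _ ∷ _} f ax ()
    ccut {Δ₀ = []}    f IR ()
    ccut {Δ₀ = _ ∷ _} f IR ()
    ccut f (IL g) eq = IL (ccut f g eq)
    ccut {Δ₀ = Δ₀} f (⊗L {B = B} g) eq = ⊗L (ccut {Δ₀ = B ∷ Δ₀} f g (cong (B ∷_) eq))
    ccut {Δ₀ = []}    f (pass g) refl = scut f g
    ccut {Δ₀ = _ ∷ _} f (pass g) refl = pass (ccut f g refl)
    ccut {Γ = Γ} {Δ₀ = Δ₀} {Δ₁} f (⊸L {Δ} {Δ'} g₁ g₂) eq with ++≡++∷-cases Δ Δ' Δ₀ Δ₁ eq
    ... | inj₁ (Λ , refl , refl) = cast (++-assoc₄ Δ₀ Γ Λ Δ') (⊸L (ccut f g₁ refl) g₂)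
    ... | inj₂ (Λ , refl , refl) = cast (sym (++-assoc Δ Λ (Γ ++ Δ₁))) (⊸L g₁ (ccut f g₂ refl))
    ccut {Γ = Γ} {Δ₀ = Δ₀} {Δ₁} f (⊗R {Γ = Δ} {Δ = Δ'} g₁ g₂) eq with ++≡++∷-cases Δ Δ' Δ₀ Δ₁ eq
    ... | inj₁ (Λ , refl , refl) = cast (++-assoc₄ Δ₀ Γ Λ Δ') (⊗R (ccut f g₁ refl) g₂)
    ... | inj₂ (Λ , refl , refl) = cast (sym (++-assoc Δ Λ (Γ ++ Δ₁))) (⊗R g₁ (ccut f g₂ refl))
    ccut {Γ = Γ} {Δ₀ = Δ₀} {Δ₁} {A} f (⊸R {A = B} g) refl =
      ⊸R (cast (sym (++-assoc₄ Δ₀ Γ Δ₁ (B ∷ [])))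
               (ccut {Δ₀ = Δ₀} {Δ₁ = Δ₁ ++ B ∷ []} f g (++-assoc Δ₀ (A ∷ Δ₁) (B ∷ []))))

mainTheorem1 : {At : Set} →
    ((S : Stp At) (Γ Δ : Cxt At) (A C : Fma At) →
      S ∣ Γ ⊢ A → just A ∣ Δ ⊢ C → S ∣ Γ ++ Δ ⊢ C)
    ×
    ((S : Stp At) (Γ Δ₀ Δ₁ : Cxt At) (A C : Fma At) →
      nothing ∣ Γ ⊢ A → S ∣ Δ₀ ++ A ∷ Δ₁ ⊢ C → S ∣ Δ₀ ++ Γ ++ Δ₁ ⊢ C)
mainTheorem1 = (λ _ _ _ _ _ → scut) , (λ _ _ _ _ _ _ f g → ccut f g refl)
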